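{- Let $(x_n)_{n\ge1}$ be defined by $x_1=1$ and $x_n=2x_{n-1}+\operatorname{lcm}(n,x_{n-1})$ for $n\ge2$, and for $n\ge2$ let $c_n=\frac{n}{\gcd(n,x_{n-1})}$. Let $(p,q)$ be twin primes with $q=p+2$. If $c_p=p$, then $c_q=1$. -}

module Defs where

open import Data.Nat using (ℕ; zero; suc; _+_; _*_; _/_; NonZero; ≢-nonZero)
open import Data.Nat.GCD using (gcd; gcd[m,n]≢0)
open import Data.Nat.LCM using (lcm)
open import Data.Sum using (inj₁)

-- The sequence x_n, n ≥ 1: x 1 = 1, x n = 2 x (n-1) + lcm(n, x(n-1)) for n ≥ 2.
-- x 0 is an unused dummy value (0); only x n for n ≥ 1 is meaningful.
x : ℕ → ℕ
x zero = 0
x (suc zero) = 1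
x (suc (suc k)) = 2 * x (suc k) + lcm (suc (suc k)) (x (suc k))

gcd-nonZero : ∀ m y → NonZero (gcd (suc m) y)
gcd-nonZero m y = ≢-nonZero (gcd[m,n]≢0 (suc m) y (inj₁ (λ ())))

-- c n = n / gcd(n, x (n-1)) for n ≥ 1 (the paper uses it for n ≥ 2);
-- c 0 is an unused dummy value.
c : ℕ → ℕ
c zero = 0
c (suc m) = (suc m / gcd (suc m) (x m)) {{gcd-nonZero m (x m)}}

{-# OPTIONS --safe #-}
module Submission where

-- If c_p = p then gcd(p, x_{p-1}) = 1, so lcm(p, x_{p-1}) = p x_{p-1} and
-- x_p = (p + 2) x_{p-1}.  Since x_p divides lcm(p + 1, x_p), it divides x_{p+1},
-- hence so does q = p + 2; then gcd(q, x_{q-1}) = q and c_q = 1.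

open import Defs
open import Data.Nat using (ℕ; zero; suc; _+_; _*_; _/_)
open import Data.Nat.Primality using (Prime)
open import Data.Nat.Properties using (*-identityʳ; *-identityˡ; *-cancelˡ-≡; *-distribʳ-+; +-comm)
open import Data.Nat.Divisibility using (_∣_; ∣-refl; ∣-trans; ∣-antisym; ∣m∣n⇒∣m+n; n∣m*n; m∣m*n)
open import Data.Nat.DivMod using (m/n*n≡m; /-congʳ; n/n≡1)
open import Data.Nat.GCD using (gcd; gcd[m,n]∣m; gcd-greatest)
open import Data.Nat.LCM using (lcm; n∣lcm[m,n]; gcd*lcm)
open import Relation.Binary.PropositionalEquality using (_≡_; sym; cong; subst; module ≡-Reasoning)

open ≡-Reasoning

gcd≡1⇒lcm≡* : ∀ m n → gcd m n ≡ 1 → lcm m n ≡ m * n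
gcd≡1⇒lcm≡* m n gcd≡1 = begin
  lcm m n           ≡⟨ sym (*-identityˡ (lcm m n)) ⟩
  1 * lcm m n       ≡⟨ cong (_* lcm m n) (sym gcd≡1) ⟩
  gcd m n * lcm m n ≡⟨ gcd*lcm m n ⟩
  m * n             ∎

c*gcd≡n : ∀ m → c (suc m) * gcd (suc m) (x m) ≡ suc m
c*gcd≡n m = m/n*n≡m {{gcd-nonZero m (x m)}} (gcd[m,n]∣m (suc m) (x m))

c≡n⇒gcd≡1 : ∀ m → c (suc m) ≡ suc m → gcd (suc m) (x m) ≡ 1
c≡n⇒gcd≡1 m c≡n = sym (*-cancelˡ-≡ 1 g (suc m) (begin
  suc m * 1     ≡⟨ *-identityʳ (suc m) ⟩
  suc m         ≡⟨ sym (c*gcd≡n m) ⟩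
  c (suc m) * g ≡⟨ cong (_* g) c≡n ⟩
  suc m * g     ∎))
  where g = gcd (suc m) (x m)

∣x⇒c≡1 : ∀ m → suc m ∣ x m → c (suc m) ≡ 1
∣x⇒c≡1 m n∣x = begin
  (suc m / gcd (suc m) (x m)) {{gcd-nonZero m (x m)}} ≡⟨ /-congʳ {{gcd-nonZero m (x m)}} gcd≡n ⟩
  suc m / suc m                                       ≡⟨ n/n≡1 (suc m) ⟩
  1                                                   ∎
  where
  gcd≡n : gcd (suc m) (x m) ≡ suc m
  gcd≡n = ∣-antisym (gcd[m,n]∣m (suc m) (x m)) (gcd-greatest ∣-refl n∣x)

x∣x-suc : ∀ m → x (suc m) ∣ x (suc (suc m))
x∣x-suc m = ∣m∣n⇒∣m+n (n∣m*n 2) (n∣lcm[m,n] (suc (suc m)) (x (suc m)))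

gcd≡1⇒x≡[n+2]*x : ∀ k → gcd (2 + k) (x (1 + k)) ≡ 1 → x (2 + k) ≡ (4 + k) * x (1 + k)
gcd≡1⇒x≡[n+2]*x k gcd≡1 = begin
  2 * y + lcm (2 + k) y ≡⟨ cong (2 * y +_) (gcd≡1⇒lcm≡* (2 + k) y gcd≡1) ⟩
  2 * y + (2 + k) * y   ≡⟨ sym (*-distribʳ-+ y 2 (2 + k)) ⟩
  (4 + k) * y           ∎
  where y = x (1 + k)

c≡n⇒c[n+2]≡1 : ∀ k → c (2 + k) ≡ 2 + k → c (4 + k) ≡ 1
c≡n⇒c[n+2]≡1 k c≡n = ∣x⇒c≡1 (3 + k) (∣-trans q∣x[p] (x∣x-suc (1 + k)))
  where
  q∣x[p] : 4 + k ∣ x (2 + k)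
  q∣x[p] = subst (4 + k ∣_) (sym (gcd≡1⇒x≡[n+2]*x k (c≡n⇒gcd≡1 (1 + k) c≡n))) (m∣m*n (x (1 + k)))

-- Primality is only needed to rule out p < 2.
lemma9p1 : (p : ℕ) → Prime p → Prime (p + 2) → c p ≡ p → c (p + 2) ≡ 1
lemma9p1 zero             ()
lemma9p1 (suc zero)       ()
lemma9p1 (suc (suc k)) _ _ c≡p rewrite +-comm k 2 = c≡n⇒c[n+2]≡1 k c≡p
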